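{- Let $\mathcal{S}$ be a balanced system of $\mathbb{Z}$-equations and assume some equation of $\mathcal{S}$ is dominant, with dominant coefficient $b\geq2$. Then for every prime $p>b$ there exists $n_0=n_0(p)$ such that for every $n\geq n_0$, \[ \mathrm{ex}^{\sharp}_{\mathcal{S}}(n,p)\geq \left(\frac{p}{b}\right)^n . \]
   Context: A $\mathbb{Z}$-equation $\sum_{i=1}^r b_ix_i=0$ is balanced if $\sum_i b_i=0$; a system is balanced if all equations are. A balanced equation is dominant if there is $j$ with $b_j>0$ and $b_i\leq0$ for all $i\neq j$, or $b_j<0$ and $b_i\geq0$ for all $i\neq j$; its dominant coefficient is $|b_j|$. For a prime $p$, $\mathcal{S}(p)$ is the mod $p$ reduction of $\mathcal{S}$. $A\subseteq\mathbb{F}_p^n$ is weakly $\mathcal{S}(p)$-free if there is no solution $(x_1,\dots,x_r)\in A^r$ of $\mathcal{S}(p)$ with pairwise distinct $x_1,\dots,x_r$; $\mathrm{ex}^{\sharp}_{\mathcal{S}}(n,p)$ is the maximum size of such $A$. -}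

module Defs where

open import Data.Nat using (ℕ)
open import Data.Integer using (ℤ; +_; _+_; _*_; _≤_; _<_; ∣_∣; 0ℤ)
open import Data.Integer.Divisibility using (_∣_)
open import Data.Fin using (Fin; zero; suc; toℕ)
open import Data.Vec using (Vec; lookup)
open import Data.List using (List)
open import Data.List.Membership.Propositional using (_∈_)
open import Data.Product using (Σ; _×_)
open import Data.Sum using (_⊎_)
open import Relation.Binary.PropositionalEquality using (_≡_; _≢_)
open import Relation.Nullary using (¬_)

∑ : ∀ {r} → (Fin r → ℤ) → ℤ
∑ {ℕ.zero} f = 0ℤ
∑ {ℕ.suc r} f = f zero + ∑ (λ i → f (suc i))

-- A Z-equation in r variables: its coefficient vector (b_1, ..., b_r).
Equation : ℕ → Set
Equation r = Fin r → ℤ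

System : ℕ → ℕ → Set
System m r = Fin m → Equation r

Balanced : ∀ {r} → Equation r → Set
Balanced b = ∑ b ≡ 0ℤ

BalancedSystem : ∀ {m r} → System m r → Set
BalancedSystem S = ∀ e → Balanced (S e)

DominantWith : ∀ {r} → Equation r → ℕ → Set
DominantWith {r} b d =
  Balanced b ×
  Σ (Fin r) λ j →
    ((0ℤ < b j × (∀ i → i ≢ j → b i ≤ 0ℤ))
      ⊎ (b j < 0ℤ × (∀ i → i ≢ j → 0ℤ ≤ b i)))
    × ∣ b j ∣ ≡ d

-- Points of F_p^n, with F_p represented by Fin p (residues 0..p-1).
Point : ℕ → ℕ → Set
Point p n = Vec (Fin p) n

SolvesModP : ∀ {m r} → System m r → (p n : ℕ) → (Fin r → Point p n) → Set
SolvesModP S p n x =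
  ∀ e (k : Fin n) → (+ p) ∣ ∑ (λ i → S e i * (+ toℕ (lookup (x i) k)))

WeaklyFree : ∀ {m r} → System m r → (p n : ℕ) → List (Point p n) → Set
WeaklyFree {r = r} S p n A =
  (x : Fin r → Point p n) →
  (∀ i → x i ∈ A) →
  (∀ i j → i ≢ j → x i ≢ x j) →
  ¬ SolvesModP S p n x

-- Normalise the dominant equation to  Σ c_i x_i ≡ 0 (mod p)  where c_j = b is the only
-- positive coefficient and Σ c_i = 0.  On the cube {0,…,L}^n with L = ⌊p/b⌋ we have
-- |Σ c_i x_i(k)| ≤ bL < p, so a solution mod p is a solution over ℤ.  If moreover all
-- x_i lie on one sphere |x|² = v, then for every y
--   Σ c_i |x_i − y|² = Σ c_i |x_i|² − 2⟨y, Σ c_i x_i⟩ + |y|² Σ c_i = 0,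
-- and for y = x_j every term is ≤ 0; hence x_i = x_j whenever c_i ≠ 0, and a solution with
-- distinct entries would force c_j = Σ c_i = 0.  By pigeonhole some sphere holds a
-- 1/(nL² + 1) share of the (L + 1)^n cube points, and since b(L + 1) > p this beats
-- (p/b)^n as soon as (p + 1)^n ≥ (nL² + 1) p^n.
module Submission where

open import Defs
open import Data.Fin using (Fin)
open import Data.Integer as ℤ using (ℤ; 0ℤ)
open import Relation.Binary.PropositionalEquality using (_≡_; _≢_)

module WeightedSums where

  open import Data.Fin using (zero; suc; punchIn)
  open import Data.Fin.Properties using (punchInᵢ≢i)
  open import Data.Integer
    using (+_; +[1+_]; -[1+_]; -1ℤ; _+_; _-_; _*_; -_; _≤_; _<_; +≤+; nonPositive)
  open import Data.Integer.Divisibility using (_∣_)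
  open import Data.Integer.Properties
  open import Data.Integer.Solver using (module +-*-Solver)
  import Data.Nat as ℕ
  open import Data.Nat.Divisibility using (>⇒∤)
  open import Data.Sum using ([_,_]′)
  open import Data.Vec.Functional using (Vector; removeAt; zipWith)
  open import Function using (_∘_; id)
  open import Relation.Binary.PropositionalEquality
  open import Relation.Nullary using (contradiction)
  open import Algebra.Properties.Semiring.Sum +-*-semiring public
    using (sum; sum-cong-≗)
  open import Algebra.Properties.Semiring.Sum +-*-semiring
    using (sum-remove; sum-replicate-zero; ∑-distrib-+; ∑-comm; *-distribˡ-sum; *-distribʳ-sum)

  ∑≡sum : ∀ {r} (f : Fin r → ℤ) → ∑ f ≡ sum f
  ∑≡sum {ℕ.zero} f = refl
  ∑≡sum {ℕ.suc r} f = cong (λ s → f zero + s) (∑≡sum (f ∘ suc))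

  sum-mono-≤ : ∀ {n} {f g : Vector ℤ n} → (∀ i → f i ≤ g i) → sum f ≤ sum g
  sum-mono-≤ {ℕ.zero} f≤g = ≤-refl
  sum-mono-≤ {ℕ.suc n} f≤g = +-mono-≤ (f≤g zero) (sum-mono-≤ (f≤g ∘ suc))

  sum-nonpos : ∀ {n} {f : Vector ℤ n} → (∀ i → f i ≤ 0ℤ) → sum f ≤ 0ℤ
  sum-nonpos {n} f≤0 = ≤-trans (sum-mono-≤ f≤0) (≤-reflexive (sum-replicate-zero n))

  sum-nonneg : ∀ {n} {f : Vector ℤ n} → (∀ i → 0ℤ ≤ f i) → 0ℤ ≤ sum f
  sum-nonneg {n} 0≤f = ≤-trans (≤-reflexive (sym (sum-replicate-zero n))) (sum-mono-≤ 0≤f)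

  sum-≤-single : ∀ {n} {f : Vector ℤ n} j → (∀ i → i ≢ j → f i ≤ 0ℤ) → sum f ≤ f j
  sum-≤-single {ℕ.suc _} {f} j f≤0 = begin
    sum f                   ≡⟨ sum-remove f ⟩
    f j + sum (removeAt f j) ≤⟨ +-monoʳ-≤ (f j) (sum-nonpos (λ k → f≤0 _ (punchInᵢ≢i j k))) ⟩
    f j + 0ℤ                ≡⟨ +-identityʳ (f j) ⟩
    f j                     ∎
    where open ≤-Reasoning

  sum-single : ∀ {n} {f : Vector ℤ n} j → (∀ i → i ≢ j → f i ≡ 0ℤ) → sum f ≡ f j
  sum-single {ℕ.suc n} {f} j f≡0 = begin
    sum f                   ≡⟨ sum-remove f ⟩
    f j + sum (removeAt f j) ≡⟨ cong (λ s → f j + s) (sum-cong-≗ (λ k → f≡0 _ (punchInᵢ≢i j k))) ⟩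
    f j + sum {n} (λ _ → 0ℤ) ≡⟨ cong (λ s → f j + s) (sum-replicate-zero n) ⟩
    f j + 0ℤ                ≡⟨ +-identityʳ (f j) ⟩
    f j                     ∎
    where open ≡-Reasoning

  sum-nonpos-≡0 : ∀ {n} {f : Vector ℤ n} → (∀ i → f i ≤ 0ℤ) → sum f ≡ 0ℤ → ∀ i → f i ≡ 0ℤ
  sum-nonpos-≡0 {ℕ.suc _} {f} f≤0 ∑f≡0 i = ≤-antisym (f≤0 i) (begin
    0ℤ                       ≡⟨ sym ∑f≡0 ⟩
    sum f                    ≤⟨ sum-≤-single i (λ k _ → f≤0 k) ⟩
    f i                      ∎)
    where open ≤-Reasoning

  sum-nonneg-≡0 : ∀ {n} {f : Vector ℤ n} → (∀ i → 0ℤ ≤ f i) → sum f ≡ 0ℤ → ∀ i → f i ≡ 0ℤ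
  sum-nonneg-≡0 {ℕ.suc _} {f} 0≤f ∑f≡0 i = ≤-antisym (begin
    f i                      ≡⟨ +-identityʳ (f i) ⟨
    f i + 0ℤ                 ≤⟨ +-monoʳ-≤ (f i) (sum-nonneg (λ k → 0≤f (punchIn i k))) ⟩
    f i + sum (removeAt f i) ≡⟨ sum-remove f ⟨
    sum f                    ≡⟨ ∑f≡0 ⟩
    0ℤ                       ∎) (0≤f i)
    where open ≤-Reasoning

  sum-neg : ∀ {n} (f : Vector ℤ n) → sum (λ i → - f i) ≡ - sum f
  sum-neg f = begin
    sum (λ i → - f i)       ≡⟨ sum-cong-≗ (λ i → -1*i≡-i (f i)) ⟨
    sum (λ i → -1ℤ * f i)   ≡⟨ *-distribˡ-sum -1ℤ f ⟨
    -1ℤ * sum f             ≡⟨ -1*i≡-i (sum f) ⟩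
    - sum f                 ∎
    where open ≡-Reasoning

  sum-const : ∀ n x → sum {n} (λ _ → + x) ≡ + (n ℕ.* x)
  sum-const ℕ.zero x = refl
  sum-const (ℕ.suc n) x = trans (cong (λ s → + x + s) (sum-const n x)) (pos-+ x (n ℕ.* x))

  *-nonpos-nonneg : ∀ {a b} → a ≤ 0ℤ → 0ℤ ≤ b → a * b ≤ 0ℤ
  *-nonpos-nonneg {a} a≤0 0≤b = subst (a * _ ≤_) (*-zeroʳ a) (*-monoˡ-≤-nonPos a {{nonPositive a≤0}} 0≤b)

  0≤i*i : ∀ i → 0ℤ ≤ i * i
  0≤i*i (+ n) = subst (0ℤ ≤_) (pos-* n n) (+≤+ ℕ.z≤n)
  0≤i*i -[1+ n ] = +≤+ ℕ.z≤n

  i*i≡0⇒i≡0 : ∀ i → i * i ≡ 0ℤ → i ≡ 0ℤ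
  i*i≡0⇒i≡0 i i*i≡0 = [ id , id ]′ (i*j≡0⇒i≡0∨j≡0 i i*i≡0)

  ∥_∥² : ∀ {n} → Vector ℤ n → ℤ
  ∥ u ∥² = sum (λ k → u k * u k)

  dist² : ∀ {n} → Vector ℤ n → Vector ℤ n → ℤ
  dist² u w = ∥ zipWith _-_ u w ∥²

  0≤dist² : ∀ {n} (u w : Vector ℤ n) → 0ℤ ≤ dist² u w
  0≤dist² u w = sum-nonneg (λ k → 0≤i*i (u k - w k))

  dist²-self : ∀ {n} (u : Vector ℤ n) → dist² u u ≡ 0ℤ
  dist²-self {n} u = trans (sum-cong-≗ (λ k → cong (λ d → d * d) (+-inverseʳ (u k)))) (sum-replicate-zero n)

  dist²≡0⇒≗ : ∀ {n} (u w : Vector ℤ n) → dist² u w ≡ 0ℤ → u ≗ w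
  dist²≡0⇒≗ u w u-w≡0 k =
    i-j≡0⇒i≡j (u k) (w k) (i*i≡0⇒i≡0 _ (sum-nonneg-≡0 (λ k → 0≤i*i (u k - w k)) u-w≡0 k))

  sum-weighted-square-shift : ∀ {r} (c a : Vector ℤ r) t →
    sum (λ i → c i * ((a i - t) * (a i - t))) ≡
    sum (λ i → c i * (a i * a i)) + (- (+ 2 * t) * sum (λ i → c i * a i) + t * t * sum c)
  sum-weighted-square-shift c a t = begin
    sum (λ i → c i * ((a i - t) * (a i - t)))
      ≡⟨ sum-cong-≗ (λ i → expand (c i) (a i)) ⟩
    sum (λ i → ca² i + (- (+ 2 * t) * ca i + t * t * c i))
      ≡⟨ ∑-distrib-+ ca² _ ⟩
    sum ca² + sum (λ i → - (+ 2 * t) * ca i + t * t * c i)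
      ≡⟨ cong (λ s → sum ca² + s) (∑-distrib-+ (λ i → - (+ 2 * t) * ca i) _) ⟩
    sum ca² + (sum (λ i → - (+ 2 * t) * ca i) + sum (λ i → t * t * c i))
      ≡⟨ cong₂ (λ u w → sum ca² + (u + w)) (*-distribˡ-sum (- (+ 2 * t)) ca) (*-distribˡ-sum (t * t) c) ⟨
    sum ca² + (- (+ 2 * t) * sum ca + t * t * sum c) ∎
    where
    open ≡-Reasoning
    open +-*-Solver
    ca² ca : Vector ℤ _
    ca² i = c i * (a i * a i)
    ca i = c i * a i
    expand : ∀ cᵢ aᵢ → cᵢ * ((aᵢ - t) * (aᵢ - t)) ≡ cᵢ * (aᵢ * aᵢ) + (- (+ 2 * t) * (cᵢ * aᵢ) + t * t * cᵢ)
    expand cᵢ aᵢ = solve 3 (λ cᵢ aᵢ t → cᵢ :* ((aᵢ :- t) :* (aᵢ :- t)) :=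
                      cᵢ :* (aᵢ :* aᵢ) :+ (:- (con (+ 2) :* t) :* (cᵢ :* aᵢ) :+ t :* t :* cᵢ)) refl cᵢ aᵢ t

  weighted-dist²-≡0 : ∀ {r n} (c : Vector ℤ r) (x : Fin r → Vector ℤ n) (y : Vector ℤ n) {v} →
    sum c ≡ 0ℤ → (∀ k → sum (λ i → c i * x i k) ≡ 0ℤ) → (∀ i → ∥ x i ∥² ≡ v) →
    sum (λ i → c i * dist² (x i) y) ≡ 0ℤ
  weighted-dist²-≡0 c x y {v} ∑c≡0 ∑cx≡0 ∥x∥²≡v = begin
    sum (λ i → c i * dist² (x i) y)
      ≡⟨ sum-cong-≗ (λ i → *-distribˡ-sum (c i) (λ k → sq (x i k - y k))) ⟩
    sum (λ i → sum (λ k → c i * sq (x i k - y k)))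
      ≡⟨ ∑-comm (λ i k → c i * sq (x i k - y k)) ⟩
    sum (λ k → sum (λ i → c i * sq (x i k - y k)))
      ≡⟨ sum-cong-≗ shift ⟩
    sum (λ k → sum (λ i → c i * sq (x i k)))
      ≡⟨ ∑-comm (λ i k → c i * sq (x i k)) ⟨
    sum (λ i → sum (λ k → c i * sq (x i k)))
      ≡⟨ sum-cong-≗ (λ i → *-distribˡ-sum (c i) (λ k → sq (x i k))) ⟨
    sum (λ i → c i * ∥ x i ∥²)
      ≡⟨ sum-cong-≗ (λ i → cong (c i *_) (∥x∥²≡v i)) ⟩
    sum (λ i → c i * v)
      ≡⟨ *-distribʳ-sum v c ⟨
    sum c * v
      ≡⟨ cong (_* v) ∑c≡0 ⟩
    0ℤ * v
      ≡⟨ *-zeroˡ v ⟩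
    0ℤ ∎
    where
    open ≡-Reasoning
    sq : ℤ → ℤ
    sq a = a * a
    shift : ∀ k → sum (λ i → c i * sq (x i k - y k)) ≡ sum (λ i → c i * sq (x i k))
    shift k = begin
      sum (λ i → c i * sq (x i k - y k))
        ≡⟨ sum-weighted-square-shift c (λ i → x i k) (y k) ⟩
      ∑cx² + (- (+ 2 * y k) * sum (λ i → c i * x i k) + y k * y k * sum c)
        ≡⟨ cong₂ (λ u w → ∑cx² + (- (+ 2 * y k) * u + y k * y k * w)) (∑cx≡0 k) ∑c≡0 ⟩
      ∑cx² + (- (+ 2 * y k) * 0ℤ + y k * y k * 0ℤ)
        ≡⟨ cong₂ (λ u w → ∑cx² + (u + w)) (*-zeroʳ (- (+ 2 * y k))) (*-zeroʳ (y k * y k)) ⟩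
      ∑cx² + 0ℤ
        ≡⟨ +-identityʳ ∑cx² ⟩
      ∑cx² ∎
      where ∑cx² = sum (λ i → c i * sq (x i k))

  multiple-between-≡0 : ∀ {p B t} → B < + p → - B ≤ t → t ≤ B → + p ∣ t → t ≡ 0ℤ
  multiple-between-≡0 {t = + ℕ.zero} _ _ _ _ = refl
  multiple-between-≡0 {t = +[1+ k ]} B<p _ t≤B p∣t = contradiction p∣t (>⇒∤ (drop‿+<+ (≤-<-trans t≤B B<p)))
  multiple-between-≡0 {B = B} {t = -[1+ k ]} B<p -B≤t _ p∣t = contradiction p∣t (>⇒∤ (drop‿+<+ (≤-<-trans -t≤B B<p)))
    where
    -t≤B : +[1+ k ] ≤ B
    -t≤B = subst (+[1+ k ] ≤_) (neg-involutive B) (neg-mono-≤ -B≤t)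

open WeightedSums

module DominantWeights {r} (c : Fin r → ℤ) (j : Fin r)
  (balanced : sum c ≡ 0ℤ) (others-nonpos : ∀ i → i ≢ j → c i ℤ.≤ 0ℤ) where

  open import Data.Fin using () renaming (_≟_ to _≟ᶠ_)
  open import Data.Integer using (+_; -_; _+_; _-_; _*_; _≤_; _<_; -1ℤ; nonNegative)
  open import Data.Integer.Divisibility using (_∣_)
  open import Data.Integer.Properties
  open import Data.Integer.Solver using (module +-*-Solver)
  open import Data.Sum using ([_,_]′)
  open import Data.Vec.Functional using (Vector)
  open import Function using (id)
  open import Relation.Binary.PropositionalEquality
  open import Relation.Nullary using (¬_; yes; no; contradiction)
  open import Relation.Nullary.Decidable using (decidable-stable)
  open import Algebra.Properties.Semiring.Sum +-*-semiring using (∑-distrib-+; *-distribˡ-sum; *-distribʳ-sum)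

  0≤cⱼ : 0ℤ ≤ c j
  0≤cⱼ = subst (_≤ c j) balanced (sum-≤-single j others-nonpos)

  weighted-sum-≤ : ∀ {L} (x : Vector ℤ r) → (∀ i → 0ℤ ≤ x i) → (∀ i → x i ≤ L) →
                   sum (λ i → c i * x i) ≤ c j * L
  weighted-sum-≤ x 0≤x x≤L = ≤-trans
    (sum-≤-single j (λ i i≢j → *-nonpos-nonneg (others-nonpos i i≢j) (0≤x i)))
    (*-monoˡ-≤-nonNeg (c j) {{nonNegative 0≤cⱼ}} (x≤L j))

  weighted-sum-reflect : ∀ L (x : Vector ℤ r) → sum (λ i → c i * (L - x i)) ≡ - sum (λ i → c i * x i)
  weighted-sum-reflect L x = begin
    sum (λ i → c i * (L - x i))                  ≡⟨ sum-cong-≗ (λ i → split (c i) (x i)) ⟩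
    sum (λ i → c i * L + -1ℤ * cx i)             ≡⟨ ∑-distrib-+ (λ i → c i * L) _ ⟩
    sum (λ i → c i * L) + sum (λ i → -1ℤ * cx i) ≡⟨ cong₂ _+_ (*-distribʳ-sum L c) (*-distribˡ-sum -1ℤ cx) ⟨
    sum c * L + -1ℤ * sum cx                     ≡⟨ cong (λ s → s * L + -1ℤ * sum cx) balanced ⟩
    0ℤ * L + -1ℤ * sum cx                        ≡⟨ trans (+-identityˡ _) (-1*i≡-i (sum cx)) ⟩
    - sum cx                                     ∎
    where
    cx : Vector ℤ r
    cx i = c i * x i
    open ≡-Reasoning
    open +-*-Solver
    split : ∀ cᵢ xᵢ → cᵢ * (L - xᵢ) ≡ cᵢ * L + -1ℤ * (cᵢ * xᵢ)
    split cᵢ xᵢ = solve 3 (λ cᵢ xᵢ L → cᵢ :* (L :- xᵢ) := cᵢ :* L :+ con -1ℤ :* (cᵢ :* xᵢ)) refl cᵢ xᵢ L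

  weighted-sum-≥ : ∀ {L} (x : Vector ℤ r) → (∀ i → 0ℤ ≤ x i) → (∀ i → x i ≤ L) →
                   - (c j * L) ≤ sum (λ i → c i * x i)
  weighted-sum-≥ {L} x 0≤x x≤L = begin
    - (c j * L)                     ≤⟨ neg-mono-≤ (weighted-sum-≤ (λ i → L - x i) 0≤L-x L-x≤L) ⟩
    - sum (λ i → c i * (L - x i))   ≡⟨ cong -_ (weighted-sum-reflect L x) ⟩
    - - sum (λ i → c i * x i)       ≡⟨ neg-involutive _ ⟩
    sum (λ i → c i * x i)           ∎
    where
    open ≤-Reasoning
    0≤L-x : ∀ i → 0ℤ ≤ L - x i
    0≤L-x i = i≤j⇒0≤j-i (x≤L i)
    L-x≤L : ∀ i → L - x i ≤ L
    L-x≤L i = i-j≤i L (x i) {{nonNegative (0≤x i)}}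

  weighted-sum-multiple-≡0 : ∀ {p L} → c j * L < + p →
    (x : Vector ℤ r) → (∀ i → 0ℤ ≤ x i) → (∀ i → x i ≤ L) →
    + p ∣ sum (λ i → c i * x i) → sum (λ i → c i * x i) ≡ 0ℤ
  weighted-sum-multiple-≡0 cⱼL<p x 0≤x x≤L =
    multiple-between-≡0 cⱼL<p (weighted-sum-≥ x 0≤x x≤L) (weighted-sum-≤ x 0≤x x≤L)

  module _ {n} (x : Fin r → Vector ℤ n) {v} (on-sphere : ∀ i → ∥ x i ∥² ≡ v)
           (solution : ∀ k → sum (λ i → c i * x i k) ≡ 0ℤ) where

    sphere-solution-collapses : ∀ i → c i ≢ 0ℤ → x i ≗ x j
    sphere-solution-collapses i cᵢ≢0 = dist²≡0⇒≗ (x i) (x j)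
      ([ (λ cᵢ≡0 → contradiction cᵢ≡0 cᵢ≢0) , id ]′ (i*j≡0⇒i≡0∨j≡0 (c i) (sum-nonpos-≡0 term≤0 terms-sum-0 i)))
      where
      terms-sum-0 : sum (λ i → c i * dist² (x i) (x j)) ≡ 0ℤ
      terms-sum-0 = weighted-dist²-≡0 c x (x j) balanced solution on-sphere
      term≤0 : ∀ i → c i * dist² (x i) (x j) ≤ 0ℤ
      term≤0 i with i ≟ᶠ j
      ... | yes refl = ≤-reflexive (trans (cong (c i *_) (dist²-self (x i))) (*-zeroʳ (c i)))
      ... | no i≢j = *-nonpos-nonneg (others-nonpos i i≢j) (0≤dist² (x i) (x j))

    sphere-solution-not-distinct : c j ≢ 0ℤ → ¬ (∀ i → i ≢ j → ¬ (x i ≗ x j))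
    sphere-solution-not-distinct cⱼ≢0 distinct = cⱼ≢0 (trans (sym (sum-single j others-zero)) balanced)
      where
      others-zero : ∀ i → i ≢ j → c i ≡ 0ℤ
      others-zero i i≢j = decidable-stable (c i ≟ 0ℤ)
        (λ cᵢ≢0 → distinct i i≢j (sphere-solution-collapses i cᵢ≢0))

module DominantEquations where

  open import Data.Integer using (+_; -_; _*_; _≤_)
  open import Data.Integer.Divisibility using (_∣_)
  open import Data.Integer.Divisibility.Signed using (∣ᵤ⇒∣; ∣⇒∣ᵤ; ∣m⇒∣-m)
  open import Data.Integer.Properties
  open import Data.Nat using (ℕ)
  open import Data.Product using (_,_)
  open import Data.Sum using (inj₁; inj₂)
  open import Relation.Binary.PropositionalEquality

  -- c is a or −a, whichever makes the dominant coefficient positive.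
  record PositiveForm {r} (a : Equation r) (b : ℕ) : Set where
    field
      c : Fin r → ℤ
      j : Fin r
      balanced : sum c ≡ 0ℤ
      dominant : c j ≡ + b
      others-nonpos : ∀ i → i ≢ j → c i ≤ 0ℤ
      divisible : ∀ {p} (t : Fin r → ℤ) → + p ∣ ∑ (λ i → a i * t i) → + p ∣ sum (λ i → c i * t i)

  positive-form : ∀ {r} {a : Equation r} {b} → DominantWith a b → PositiveForm a b
  positive-form {a = a} (a-balanced , j , inj₁ (0<aⱼ , others-nonpos) , ∣aⱼ∣≡b) = record
    { c = a
    ; j = j
    ; balanced = trans (sym (∑≡sum a)) a-balanced
    ; dominant = trans (sym (0≤i⇒+∣i∣≡i (<⇒≤ 0<aⱼ))) (cong +_ ∣aⱼ∣≡b)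
    ; others-nonpos = others-nonpos
    ; divisible = λ {p} t → subst (+ p ∣_) (∑≡sum (λ i → a i * t i))
    }
  positive-form {a = a} (a-balanced , j , inj₂ (aⱼ<0 , others-nonneg) , ∣aⱼ∣≡b) = record
    { c = λ i → - a i
    ; j = j
    ; balanced = trans (sum-neg a) (cong -_ (trans (sym (∑≡sum a)) a-balanced))
    ; dominant = trans (sym (0≤i⇒+∣i∣≡i (<⇒≤ (neg-mono-< aⱼ<0)))) (cong +_ (trans (∣-i∣≡∣i∣ (a j)) ∣aⱼ∣≡b))
    ; others-nonpos = λ i i≢j → neg-mono-≤ (others-nonneg i i≢j)
    ; divisible = divisible-neg
    }
    where
    sum-neg-weighted : ∀ t → sum (λ i → - a i * t i) ≡ - sum (λ i → a i * t i)
    sum-neg-weighted t = trans (sum-cong-≗ (λ i → sym (neg-distribˡ-* (a i) (t i)))) (sum-neg (λ i → a i * t i))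

    divisible-neg : ∀ {p} t → + p ∣ ∑ (λ i → a i * t i) → + p ∣ sum (λ i → - a i * t i)
    divisible-neg {p} t p∣∑at = subst (+ p ∣_) (sym (sum-neg-weighted t))
      (∣⇒∣ᵤ (∣m⇒∣-m {+ p} {sum (λ i → a i * t i)} (∣ᵤ⇒∣ (subst (+ p ∣_) (∑≡sum (λ i → a i * t i)) p∣∑at))))

open DominantEquations

module IntegerPoints where

  open import Data.Fin using (toℕ)
  open import Data.Fin.Properties using (toℕ-injective)
  open import Data.Integer using (+_; _*_; _≤_; _<_; ∣_∣; +≤+; +<+)
  open import Data.Integer.Properties
  import Data.Nat as ℕ
  import Data.Nat.Properties as ℕ
  open import Data.List using (List)
  open import Data.List.Membership.Propositional using (_∈_)
  open import Data.Product using (_×_; proj₁; proj₂)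
  open import Data.Vec using (lookup; tabulate)
  open import Data.Vec.Functional using (Vector)
  open import Data.Vec.Properties using (tabulate∘lookup; tabulate-cong)
  open import Function using (_∘_)
  open import Relation.Binary.PropositionalEquality

  coords : ∀ {p n} → Point p n → Vector ℤ n
  coords a k = + toℕ (lookup a k)

  coords-injective : ∀ {p n} {a a′ : Point p n} → coords a ≗ coords a′ → a ≡ a′
  coords-injective {a = a} {a′} same = begin
    a                  ≡⟨ tabulate∘lookup a ⟨
    tabulate (lookup a)  ≡⟨ tabulate-cong (toℕ-injective ∘ +-injective ∘ same) ⟩
    tabulate (lookup a′) ≡⟨ tabulate∘lookup a′ ⟩
    a′                 ∎
    where open ≡-Reasoning

  normSq : ∀ {p n} → Point p n → ℕ.ℕ
  normSq a = ∣ ∥ coords a ∥² ∣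

  +normSq≡∥coords∥² : ∀ {p n} (a : Point p n) → + normSq a ≡ ∥ coords a ∥²
  +normSq≡∥coords∥² a = 0≤i⇒+∣i∣≡i (sum-nonneg (λ k → 0≤i*i (coords a k)))

  normSq-bound : ∀ {p n L} (a : Point p n) → (∀ k → toℕ (lookup a k) ℕ.≤ L) →
                 normSq a ℕ.≤ n ℕ.* (L ℕ.* L)
  normSq-bound {n = n} {L} a a≤L = drop‿+≤+ (begin
    + normSq a                  ≡⟨ +normSq≡∥coords∥² a ⟩
    ∥ coords a ∥²               ≤⟨ sum-mono-≤ coord²≤ ⟩
    sum {n} (λ _ → + (L ℕ.* L)) ≡⟨ sum-const n (L ℕ.* L) ⟩
    + (n ℕ.* (L ℕ.* L))         ∎)
    where
    open ≤-Reasoning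
    coord²≤ : ∀ k → coords a k * coords a k ≤ + (L ℕ.* L)
    coord²≤ k = subst (_≤ + (L ℕ.* L)) (pos-* (toℕ (lookup a k)) (toℕ (lookup a k)))
                      (+≤+ (ℕ.*-mono-≤ (a≤L k) (a≤L k)))

  module _ {m r} (S : System m r) {e b} (form : PositiveForm (S e) b) (b≢0 : b ≢ 0) where

    open PositiveForm form
    open DominantWeights c j balanced others-nonpos

    bounded-sphere-weakly-free : ∀ {p n} L v → b ℕ.* L ℕ.< p → (A : List (Point p n)) →
      (∀ {a} → a ∈ A → (∀ k → toℕ (lookup a k) ℕ.≤ L) × normSq a ≡ v) → WeaklyFree S p n A
    bounded-sphere-weakly-free {p} L v bL<p A in-A x x∈A distinct solves =
      sphere-solution-not-distinct X X-on-sphere X-solution cⱼ≢0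
        (λ i i≢j Xᵢ≗Xⱼ → distinct i j i≢j (coords-injective Xᵢ≗Xⱼ))
      where
      X : Fin r → Vector ℤ _
      X i = coords (x i)
      X-on-sphere : ∀ i → ∥ X i ∥² ≡ + v
      X-on-sphere i = trans (sym (+normSq≡∥coords∥² (x i))) (cong +_ (proj₂ (in-A (x∈A i))))
      cⱼL<p : c j * + L < + p
      cⱼL<p = subst (_< + p) (trans (pos-* b L) (cong (_* + L) (sym dominant))) (+<+ bL<p)
      X-solution : ∀ k → sum (λ i → c i * X i k) ≡ 0ℤ
      X-solution k = weighted-sum-multiple-≡0 cⱼL<p (λ i → X i k) (λ i → +≤+ ℕ.z≤n)
        (λ i → +≤+ (proj₁ (in-A (x∈A i)) k)) (divisible (λ i → X i k) (solves e k))
      cⱼ≢0 : c j ≢ 0ℤ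
      cⱼ≢0 cⱼ≡0 = b≢0 (+-injective (trans (sym dominant) cⱼ≡0))

open IntegerPoints

open import Data.Nat
open import Data.Nat.Properties
open import Data.Nat.DivMod using (_/_; _%_; m≡m%n+[m/n]*n; m%n<n)
open import Data.Nat.Divisibility using (_∤_; m%n≡0⇒n∣m)
open import Data.Nat.Primality using (Prime; prime⇒irreducible; prime⇒nonZero)
open import Data.Nat.Solver using (module +-*-Solver)
open import Data.Fin using (zero; suc; toℕ; inject≤)
open import Data.Fin.Properties using (toℕ<n; toℕ-inject≤; inject≤-injective)
open import Data.List as List using (List; []; _∷_; [_]; length; filter; map; allFin; cartesianProductWith)
open import Data.List.Properties using (length-++; length-map; length-tabulate; filter-all)
open import Data.List.Membership.Propositional using (_∈_)
open import Data.List.Membership.Propositional.Properties using (∈-map⁻; ∈-cartesianProductWith⁻; ∈-filter⁻)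
import Data.List.Relation.Binary.Sublist.Propositional.Properties as Sublist
open import Data.List.Relation.Unary.All as All using (All)
open import Data.List.Relation.Unary.All.Properties as All using (all-filter)
open import Data.List.Relation.Unary.Unique.Propositional using (Unique)
open import Data.List.Relation.Unary.Unique.Propositional.Properties as Unique
  using (allFin⁺; cartesianProductWith⁺)
open import Data.List.Relation.Unary.AllPairs as AllPairs using ()
open import Data.Product using (Σ; ∃-syntax; _×_; _,_)
open import Data.Sum using ([_,_]′)
open import Data.Vec using ([]; _∷_; lookup)
open import Data.Vec.Properties using (∷-injective)
open import Function using (_∘_)
open import Relation.Binary.PropositionalEquality
  using (refl; sym; trans; cong; cong₂; subst; module ≡-Reasoning)
open import Relation.Nullary using (yes; no; ¬?)
open import Relation.Unary using (Decidable)

length-cartesianProductWith : ∀ {A B C : Set} (f : A → B → C) xs ys →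
  length (cartesianProductWith f xs ys) ≡ length xs * length ys
length-cartesianProductWith f [] ys = refl
length-cartesianProductWith f (x ∷ xs) ys = begin
  length (map (f x) ys List.++ cartesianProductWith f xs ys)
    ≡⟨ length-++ (map (f x) ys) ⟩
  length (map (f x) ys) + length (cartesianProductWith f xs ys)
    ≡⟨ cong₂ _+_ (length-map (f x) ys) (length-cartesianProductWith f xs ys) ⟩
  length ys + length xs * length ys ∎
  where open ≡-Reasoning

length-filter-complement : ∀ {A : Set} {P : A → Set} (P? : Decidable P) xs →
  length xs ≡ length (filter P? xs) + length (filter (λ x → ¬? (P? x)) xs)
length-filter-complement P? [] = refl
length-filter-complement P? (x ∷ xs) with P? x
... | yes _ = cong suc (length-filter-complement P? xs)
... | no _ = trans (cong suc (length-filter-complement P? xs)) (sym (+-suc _ _))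

module _ {A : Set} (g : A → ℕ) where

  fibre : ℕ → List A → List A
  fibre v = filter (λ a → g a ≟ v)

  length-fibre-filter : ∀ {Q : A → Set} (Q? : Decidable Q) v xs →
                        length (fibre v (filter Q? xs)) ≤ length (fibre v xs)
  length-fibre-filter Q? v xs = Sublist.length-mono-≤
    (Sublist.filter⁺ (λ a → g a ≟ v) (λ a → g a ≟ v) (λ { refl ga≡v → ga≡v }) (Sublist.filter-⊆ Q? xs))

  below? : ∀ M → Decidable (λ a → g a ≢ M)
  below? M a = ¬? (g a ≟ M)

  all-below : ∀ M xs → All (λ a → g a ≤ suc M) xs → All (λ a → g a ≤ M) (filter (below? (suc M)) xs)
  all-below M xs g≤1+M = All.zipWith (λ (h , ne) → ≤-pred (≤∧≢⇒< h ne))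
    (All.filter⁺ (below? (suc M)) g≤1+M , all-filter (below? (suc M)) xs)

  pigeonhole : ∀ M xs → All (λ a → g a ≤ M) xs → ∃[ v ] length xs ≤ suc M * length (fibre v xs)
  pigeonhole zero xs g≤0 = 0 , ≤-reflexive (begin
    length xs               ≡⟨ cong length (filter-all (λ a → g a ≟ 0) (All.map n≤0⇒n≡0 g≤0)) ⟨
    length (fibre 0 xs)     ≡⟨ *-identityˡ _ ⟨
    1 * length (fibre 0 xs) ∎)
    where open ≡-Reasoning
  pigeonhole (suc M) xs g≤1+M with pigeonhole M (filter (below? (suc M)) xs) (all-below M xs g≤1+M)
  ... | v , ih = best
    where
    top = length (fibre (suc M) xs)
    rest = filter (below? (suc M)) xs
    bound : length xs ≤ top + suc M * length (fibre v xs)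
    bound = begin
      length xs                          ≡⟨ length-filter-complement (λ a → g a ≟ suc M) xs ⟩
      top + length rest                  ≤⟨ +-monoʳ-≤ top ih ⟩
      top + suc M * length (fibre v rest) ≤⟨ +-monoʳ-≤ top (*-monoʳ-≤ (suc M) (length-fibre-filter _ v xs)) ⟩
      top + suc M * length (fibre v xs)   ∎
      where open ≤-Reasoning
    best : ∃[ w ] length xs ≤ suc (suc M) * length (fibre w xs)
    best with top ≤? length (fibre v xs)
    ... | yes top≤v = v , ≤-trans bound (+-monoˡ-≤ _ top≤v)
    ... | no top≰v = suc M , ≤-trans bound (+-monoʳ-≤ top (*-monoʳ-≤ (suc M) (<⇒≤ (≰⇒> top≰v))))

module Cube {p s : ℕ} (s≤p : s ≤ p) where

  digits : List (Fin p)
  digits = map (λ i → inject≤ i s≤p) (allFin s)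

  length-digits : length digits ≡ s
  length-digits = trans (length-map _ (allFin s)) (length-tabulate {n = s} _)

  cube : ∀ n → List (Point p n)
  cube zero = [ [] ]
  cube (suc n) = cartesianProductWith _∷_ digits (cube n)

  cube-unique : ∀ n → Unique (cube n)
  cube-unique zero = All.[] AllPairs.∷ AllPairs.[]
  cube-unique (suc n) = cartesianProductWith⁺ _∷_ ∷-injective
    (Unique.map⁺ (inject≤-injective s≤p s≤p _ _) (allFin⁺ s)) (cube-unique n)

  length-cube : ∀ n → length (cube n) ≡ s ^ n
  length-cube zero = refl
  length-cube (suc n) = begin
    length (cube (suc n))          ≡⟨ length-cartesianProductWith _∷_ digits (cube n) ⟩
    length digits * length (cube n) ≡⟨ cong₂ _*_ length-digits (length-cube n) ⟩
    s * s ^ n                       ∎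
    where open ≡-Reasoning

  ∈digits⇒< : ∀ {d} → d ∈ digits → toℕ d < s
  ∈digits⇒< d∈ with ∈-map⁻ _ d∈
  ... | i , _ , refl = subst (_< s) (sym (toℕ-inject≤ i s≤p)) (toℕ<n i)

  ∈cube⇒< : ∀ n {a} → a ∈ cube n → ∀ k → toℕ (lookup a k) < s
  ∈cube⇒< (suc n) a∈ k with ∈-cartesianProductWith⁻ _∷_ digits (cube n) a∈
  ∈cube⇒< (suc n) a∈ zero    | _ , _ , d∈ , _ , refl = ∈digits⇒< d∈
  ∈cube⇒< (suc n) a∈ (suc k) | _ , _ , _ , a∈′ , refl = ∈cube⇒< n a∈′ k

module Sphere {p L : ℕ} (L<p : L < p) where

  open Cube L<p

  sphere : ℕ → ∀ n → List (Point p n)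
  sphere v n = fibre normSq v (cube n)

  sphere-unique : ∀ v n → Unique (sphere v n)
  sphere-unique v n = Unique.filter⁺ (λ a → normSq a ≟ v) (cube-unique n)

  ∈-sphere⁻ : ∀ {v n a} → a ∈ sphere v n → (∀ k → toℕ (lookup a k) ≤ L) × normSq a ≡ v
  ∈-sphere⁻ {v} {n} a∈ with ∈-filter⁻ (λ a → normSq a ≟ v) {xs = cube n} a∈
  ... | a∈cube , normSq≡v = (λ k → ≤-pred (∈cube⇒< n a∈cube k)) , normSq≡v

  large-sphere : ∀ n → ∃[ v ] suc L ^ n ≤ suc (n * (L * L)) * length (sphere v n)
  large-sphere n with pigeonhole normSq (n * (L * L)) (cube n)
                        (All.tabulate (λ {a} a∈ → normSq-bound a (λ k → ≤-pred (∈cube⇒< n a∈ k))))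
  ... | v , cube≤ = v , subst (_≤ suc (n * (L * L)) * length (sphere v n)) (length-cube n) cube≤

∤⇒n*[m/n]<m : ∀ m n .{{_ : NonZero n}} → n ∤ m → n * (m / n) < m
∤⇒n*[m/n]<m m n n∤m = begin-strict
  n * (m / n)         ≡⟨ *-comm n (m / n) ⟩
  m / n * n           <⟨ +-monoˡ-< (m / n * n) (n≢0⇒n>0 (n∤m ∘ m%n≡0⇒n∣m m n)) ⟩
  m % n + m / n * n   ≡⟨ m≡m%n+[m/n]*n m n ⟨
  m                   ∎
  where open ≤-Reasoning

m<n*[1+m/n] : ∀ m n .{{_ : NonZero n}} → m < n * suc (m / n)
m<n*[1+m/n] m n = begin-strict
  m                   ≡⟨ m≡m%n+[m/n]*n m n ⟩
  m % n + m / n * n   <⟨ +-monoˡ-< (m / n * n) (m%n<n m n) ⟩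
  n + m / n * n       ≡⟨ cong (n +_) (*-comm (m / n) n) ⟩
  n + n * (m / n)     ≡⟨ *-suc n (m / n) ⟨
  n * suc (m / n)     ∎
  where open ≤-Reasoning

prime⇒∤ : ∀ {p b} → Prime p → 2 ≤ b → b < p → b ∤ p
prime⇒∤ p-prime 2≤b b<p b∣p =
  [ (λ b≡1 → <⇒≢ 2≤b (sym b≡1)) , (λ b≡p → <-irrefl b≡p b<p) ]′ (prime⇒irreducible p-prime b∣p)

-- (1 + 1/p)^n ≥ 1 + n/p + n(n − 1)/(2p²) with denominators cleared, for n = suc m.
quadratic-bernoulli : ∀ p m →
  p ^ suc m * (2 * p * p + 2 * suc m * p + suc m * m) ≤ 2 * p * p * suc p ^ suc m
quadratic-bernoulli p zero = ≤-reflexive (solve 1 (λ p →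
  p :* con 1 :* (con 2 :* p :* p :+ con 2 :* con 1 :* p :+ con 1 :* con 0) :=
  con 2 :* p :* p :* ((con 1 :+ p) :* con 1)) refl p)
  where open +-*-Solver
quadratic-bernoulli p (suc m) = begin
  p * q * (2 * p * p + 2 * suc (suc m) * p + suc (suc m) * suc m)
    ≤⟨ m≤m+n _ (q * (suc m * m)) ⟩
  p * q * (2 * p * p + 2 * suc (suc m) * p + suc (suc m) * suc m) + q * (suc m * m)
    ≡⟨ solve 3 (λ p q m →
         p :* q :* (con 2 :* p :* p :+ con 2 :* (con 2 :+ m) :* p :+ (con 2 :+ m) :* (con 1 :+ m))
           :+ q :* ((con 1 :+ m) :* m)
         := (con 1 :+ p) :* (q :* (con 2 :* p :* p :+ con 2 :* (con 1 :+ m) :* p :+ (con 1 :+ m) :* m)))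
       refl p q m ⟩
  suc p * (q * (2 * p * p + 2 * suc m * p + suc m * m))
    ≤⟨ *-monoʳ-≤ (suc p) (quadratic-bernoulli p m) ⟩
  suc p * (2 * p * p * suc p ^ suc m)
    ≡⟨ solve 2 (λ p r → (con 1 :+ p) :* (con 2 :* p :* p :* r) := con 2 :* p :* p :* ((con 1 :+ p) :* r))
         refl p (suc p ^ suc m) ⟩
  2 * p * p * suc p ^ suc (suc m) ∎
  where
  open ≤-Reasoning
  open +-*-Solver
  q = p ^ suc m

linear-pow-≤-suc-pow : ∀ p c .{{_ : NonZero p}} n → suc (2 * p * p * c) ≤ n →
                       suc (n * c) * p ^ n ≤ suc p ^ n
linear-pow-≤-suc-pow p c (suc m) (s≤s 2ppc≤m) = *-cancelˡ-≤ (2 * p * p) {{2pp≢0}} (begin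
  2 * p * p * (suc (n * c) * q)
    ≡⟨ solve 4 (λ k q n c → k :* ((con 1 :+ n :* c) :* q) := q :* (k :+ n :* (k :* c))) refl (2 * p * p) q n c ⟩
  q * (2 * p * p + n * (2 * p * p * c))
    ≤⟨ *-monoʳ-≤ q (+-monoʳ-≤ (2 * p * p) (≤-trans (*-monoʳ-≤ n 2ppc≤m) (m≤n+m (n * m) (2 * n * p)))) ⟩
  q * (2 * p * p + (2 * n * p + n * m))
    ≡⟨ cong (q *_) (sym (+-assoc (2 * p * p) (2 * n * p) (n * m))) ⟩
  q * (2 * p * p + 2 * n * p + n * m)
    ≤⟨ quadratic-bernoulli p m ⟩
  2 * p * p * suc p ^ n ∎)
  where
  open ≤-Reasoning
  open +-*-Solver
  n = suc m
  q = p ^ n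
  2pp≢0 : NonZero (2 * p * p)
  2pp≢0 = m*n≢0 (2 * p) p {{m*n≢0 2 p}}

^-distribʳ-* : ∀ m n o → (m * n) ^ o ≡ m ^ o * n ^ o
^-distribʳ-* m n zero = refl
^-distribʳ-* m n (suc o) = trans (cong (m * n *_) (^-distribʳ-* m n o)) (interchange m n (m ^ o) (n ^ o))
  where open import Algebra.Properties.CommutativeSemigroup *-commutativeSemigroup using (interchange)

density-bound : ∀ {p b s M n k} → suc M * p ^ n ≤ suc p ^ n → suc p ≤ b * s → s ^ n ≤ suc M * k →
                p ^ n ≤ k * b ^ n
density-bound {p} {b} {s} {M} {n} {k} growth p<bs cube≤ = *-cancelˡ-≤ (suc M) (begin
  suc M * p ^ n       ≤⟨ growth ⟩
  suc p ^ n           ≤⟨ ^-monoˡ-≤ n p<bs ⟩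
  (b * s) ^ n         ≡⟨ ^-distribʳ-* b s n ⟩
  b ^ n * s ^ n       ≤⟨ *-monoʳ-≤ (b ^ n) cube≤ ⟩
  b ^ n * (suc M * k) ≡⟨ solve 3 (λ x y z → x :* (y :* z) := y :* (z :* x)) refl (b ^ n) (suc M) k ⟩
  suc M * (k * b ^ n) ∎)
  where
  open ≤-Reasoning
  open +-*-Solver

theorem5p4 : ∀ {m r} (S : System m r) → BalancedSystem S →
    (b : ℕ) → 2 ≤ b → Σ (Fin m) (λ e → DominantWith (S e) b) →
    (p : ℕ) → Prime p → b < p →
    Σ ℕ λ n₀ → (n : ℕ) → n₀ ≤ n →
      Σ (List (Point p n)) λ A →
        Unique A × WeaklyFree S p n A × p ^ n ≤ length A * b ^ n
theorem5p4 S _ b 2≤b (e , dominant) p p-prime b<p = n₀ , large-free-sphere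
  where
  instance
    b≢0 : NonZero b
    b≢0 = >-nonZero (<-trans z<s 2≤b)
    p≢0 : NonZero p
    p≢0 = prime⇒nonZero p-prime
  L = p / b
  bL<p : b * L < p
  bL<p = ∤⇒n*[m/n]<m p b (prime⇒∤ p-prime 2≤b b<p)
  open Sphere (≤-<-trans (m≤n*m L b) bL<p)
  n₀ = suc (2 * p * p * (L * L))
  large-free-sphere : (n : ℕ) → n₀ ≤ n →
    Σ (List (Point p n)) λ A → Unique A × WeaklyFree S p n A × p ^ n ≤ length A * b ^ n
  large-free-sphere n n₀≤n with large-sphere n
  ... | v , large = sphere v n , sphere-unique v n
    , bounded-sphere-weakly-free S (positive-form dominant) (≢-nonZero⁻¹ b) L v bL<p (sphere v n) ∈-sphere⁻
    , density-bound {M = n * (L * L)} {n = n} {k = length (sphere v n)}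
        (linear-pow-≤-suc-pow p (L * L) n n₀≤n) (m<n*[1+m/n] p b) large
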